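{- Let $(E,\Omega)$ be a pseudo-topological space with interior operator $\Upsilon$. For all $A,B\subseteq E$, $\Upsilon(A)\cap\Upsilon(B)\subseteq\Upsilon(A\cap B)$.
   Context: A pseudo-topological space is a pair $(E,\Omega)$ where $E$ is a nonempty set and $\Omega\subseteq\mathcal P(E)$ (the "open" sets) satisfies: (i) $A,B\in\Omega\Rightarrow A\cap B\in\Omega$; (ii) $A,B\in\Omega\Rightarrow A\cup B\in\Omega$; (iii) $E\in\Omega$; (iv) $\emptyset\notin\Omega$. For $A\subseteq E$, the interior $\Upsilon(A)$ is defined as the largest $D\in\Omega$ with $D\subseteq A$, if such a $D$ exists, and as $\emptyset$ if there is no $D\in\Omega$ with $D\subseteq A$. -}

module Defs where

open import Level using (0ℓ)
open import Data.Product using (Σ; _×_; ∃)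
open import Data.Sum using (_⊎_)
open import Relation.Nullary using (¬_)
open import Relation.Unary using (Pred; _⊆_; _∩_; _∪_; U; ∅; Empty)

Subset : Set → Set₁
Subset E = Pred E 0ℓ

record IsPseudoTopology (E : Set) (Ω : Subset E → Set) : Set₁ where
  field
    nonempty : E
    ∩-closed : ∀ {A B} → Ω A → Ω B → Ω (A ∩ B)
    ∪-closed : ∀ {A B} → Ω A → Ω B → Ω (A ∪ B)
    whole    : Ω U
    noEmpty  : ¬ Ω ∅

-- "I is the interior Υ(A)":  either I is the largest open set contained in A,
-- or there is no open set contained in A and I is empty.
IsInterior : {E : Set} → (Subset E → Set) → Subset E → Subset E → Set₁
IsInterior {E} Ω A I =
  (Ω I × I ⊆ A × (∀ (D : Subset E) → Ω D → D ⊆ A → D ⊆ I))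
  ⊎ ((¬ Σ (Subset E) (λ D → Ω D × D ⊆ A)) × Empty I)

module Submission where

open import Defs
open import Relation.Unary using (_⊆_; _∩_)
open import Data.Product using (_,_; map)
open import Data.Sum using (inj₁; inj₂)
open import Data.Empty using (⊥-elim)

-- An interior containing a point cannot be the empty junk value, so it is
-- open; hence IA ∩ IB is an open subset of A ∩ B as soon as it has a point,
-- and maximality of IAB finishes the proof.

module _ {E : Set} {Ω : Subset E → Set} {A I : Subset E} where

  interior-⊆ : IsInterior Ω A I → I ⊆ A
  interior-⊆ (inj₁ (_ , I⊆A , _)) = I⊆A
  interior-⊆ (inj₂ (_ , I-empty)) {x} x∈I = ⊥-elim (I-empty x x∈I)

  interior-open-if-inhabited : IsInterior Ω A I → ∀ {x} → I x → Ω I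
  interior-open-if-inhabited (inj₁ (ΩI , _ , _)) _ = ΩI
  interior-open-if-inhabited (inj₂ (_ , I-empty)) {x} x∈I = ⊥-elim (I-empty x x∈I)

  interior-maximal : IsInterior Ω A I → ∀ {D} → Ω D → D ⊆ A → D ⊆ I
  interior-maximal (inj₁ (_ , _ , maximal)) ΩD D⊆A = maximal _ ΩD D⊆A
  interior-maximal (inj₂ (no-open , _)) ΩD D⊆A = ⊥-elim (no-open (_ , ΩD , D⊆A))

mainTheorem3 : (E : Set) (Ω : Subset E → Set) → IsPseudoTopology E Ω →
    (A B IA IB IAB : Subset E) →
    IsInterior Ω A IA → IsInterior Ω B IB → IsInterior Ω (A ∩ B) IAB →
    (IA ∩ IB) ⊆ IAB
mainTheorem3 E Ω pt A B IA IB IAB intA intB intAB (x∈IA , x∈IB) =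
  interior-maximal intAB ΩIA∩IB (map (interior-⊆ intA) (interior-⊆ intB))
    (x∈IA , x∈IB)
  where
  ΩIA∩IB : Ω (IA ∩ IB)
  ΩIA∩IB = IsPseudoTopology.∩-closed pt
    (interior-open-if-inhabited intA x∈IA) (interior-open-if-inhabited intB x∈IB)
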